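{- Let $k,n\in\mathbb{N}$ with $n=12k$, and let $G=C_n(\{1,3,n-3,n-1\})$. Then $\lambda_{(3,2,1)}(G)=11$.
   Context: For $n\ge 3$ and $S\subseteq\{1,\dots,n-1\}$ closed under $x\mapsto n-x$, the circulant $C_n(S)$ is the graph with vertex set $\{u_1,\dots,u_n\}$ in which $u_iu_j$ is an edge iff $|i-j|\in S$. An $L(3,2,1)$-labeling of a graph $G$ is a function $f:V(G)\to\mathbb{N}\cup\{0\}$ such that $|f(x)-f(y)|>3-\operatorname{dist}_G(x,y)$ for all distinct $x,y\in V(G)$. $\lambda_{(3,2,1)}(G)$ is the minimum, over all $L(3,2,1)$-labelings of $G$, of the difference between the largest and smallest label used. -}

module Defs where

open import Data.Nat using (ℕ; zero; suc; _+_; _*_; _∸_; _<_; _≤_; _⊔_; _⊓_; ∣_-_∣)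
open import Data.Fin using (Fin; toℕ)
open import Data.List using (List; foldr; map; allFin)
open import Data.Sum using (_⊎_)
open import Data.Product using (_×_)
open import Relation.Binary.PropositionalEquality using (_≡_; _≢_)
open import Relation.Nullary using (¬_)

CircAdj : (n : ℕ) → (ℕ → Set) → Fin n → Fin n → Set
CircAdj n S i j = S ∣ toℕ i - toℕ j ∣

S1-3 : ℕ → ℕ → Set
S1-3 n d = (d ≡ 1) ⊎ (d ≡ 3) ⊎ (d ≡ n ∸ 3) ⊎ (d ≡ n ∸ 1)

data Walk {V : Set} (Adj : V → V → Set) : V → V → ℕ → Set where
  here : ∀ {x} → Walk Adj x x 0
  step : ∀ {x y z m} → Adj x y → Walk Adj y z m → Walk Adj x z (suc m)

Dist : {V : Set} → (V → V → Set) → V → V → ℕ → Set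
Dist Adj x y d = Walk Adj x y d × (∀ m → m < d → ¬ Walk Adj x y m)

-- L(3,2,1)-labeling: |f x - f y| > 3 - dist(x,y) for distinct x, y
-- (written 3 < |f x - f y| + dist to avoid truncated subtraction; if x,y
-- are in different components the condition is vacuous, as 3 - ∞ < 0).
IsL321 : {n : ℕ} → (Fin n → Fin n → Set) → (Fin n → ℕ) → Set
IsL321 Adj f = ∀ x y → x ≢ y → ∀ d → Dist Adj x y d → 3 < ∣ f x - f y ∣ + d

maxLabel : {n : ℕ} → (Fin n → ℕ) → ℕ
maxLabel {n} f = foldr _⊔_ 0 (map f (allFin n))

-- minimum of the labels (correct for n ≥ 1, since the seed is the maximum)
minLabel : {n : ℕ} → (Fin n → ℕ) → ℕ
minLabel {n} f = foldr _⊓_ (maxLabel f) (map f (allFin n))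

span : {n : ℕ} → (Fin n → ℕ) → ℕ
span f = maxLabel f ∸ minLabel f

λ321≡ : {n : ℕ} → (Fin n → Fin n → Set) → ℕ → Set
λ321≡ {n} Adj L =
  (Data.Product.Σ (Fin n → ℕ) λ f → IsL321 Adj f × span f ≡ L)
  × (∀ (f : Fin n → ℕ) → IsL321 Adj f → L ≤ span f)

-- Upper bound: label u_i by 5 i mod 12.  As 12 ∣ n this is compatible with the
-- wrap-around, and a walk of length ℓ ≤ 3 between distinct vertices moves i by a
-- nonzero signed sum of ℓ terms ±1, ±3; multiplied by 5 such a sum stays at least
-- 4 − ℓ away from 0 modulo 12, which is a finite check.
-- Lower bound: among twelve consecutive vertices u_0, …, u_11 two vertices at
-- gap g are joined by a walk of hops g steps of length 1 or 3, so their labels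
-- differ by at least 4 − hops g; a backtracking search shows that no twelve
-- labels in {0, …, 10} meet all these constraints.
module Submission where

open import Defs
open import Data.Nat using (ℕ; _*_; _≤_)
open import Relation.Binary.PropositionalEquality using (_≡_)

open import Data.Empty using (⊥-elim)
open import Data.Fin using (Fin; toℕ; fromℕ<)
open import Data.Fin.Properties using (toℕ<n; toℕ-fromℕ<; toℕ-injective)
open import Data.List using (List; []; _∷_; cartesianProductWith)
open import Data.List.Properties using (foldr-preservesᵇ; foldr-preservesᵒ)
open import Data.List.Relation.Unary.All as All using (All; lookupAny)
import Data.List.Relation.Unary.All.Properties as Allₚ
open import Data.List.Relation.Unary.Any using (Any; here; there)
import Data.List.Relation.Unary.Any.Properties as Anyₚ
open import Data.Nat
  using ( zero; suc; _+_; _∸_; _<_; _⊔_; _⊓_; ∣_-_∣; z≤n; s≤s; z<s; _≟_; _≤?_; _<?_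
        ; NonZero; >-nonZero)
open import Data.Nat.Divisibility using (_∣_; m∣m*n; ∣⇒≤)
open import Data.Nat.DivMod
  using ( _%_; m%n<n; m<n⇒m%n≡m; m%n%n≡m%n; [m+n]%n≡m%n; [m+kn]%n≡m%n; m∣n⇒o%n%m≡o%m
        ; %-distribˡ-+; %-distribˡ-*)
open import Data.Nat.Induction using (<-rec)
open import Data.Nat.Properties
open import Algebra.Properties.CommutativeSemigroup +-commutativeSemigroup
  using (x∙yz≈xz∙y; xy∙z≈xz∙y)
open import Data.Product using (∃; _×_; _,_)
open import Data.Sum using (_⊎_; inj₁; inj₂; [_,_])
open import Data.Unit using (⊤; tt)
open import Relation.Binary.PropositionalEquality
  using (refl; sym; trans; cong; cong₂; subst; subst₂; _≢_; module ≡-Reasoning)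
open import Relation.Nullary using (Dec; yes; no; ¬_; ¬?)
open import Relation.Nullary.Decidable using (_×-dec_; _→-dec_; from-yes; from-no; decidable-stable)

module _ {n : ℕ} (f : Fin n → ℕ) where

  label≤maxLabel : ∀ x → f x ≤ maxLabel f
  label≤maxLabel x =
    foldr-preservesᵒ {P = f x ≤_} {f = _⊔_} (λ a b → [ m≤n⇒m≤n⊔o b , m≤n⇒m≤o⊔n a ]) 0 _
      (inj₂ (Anyₚ.map⁺ (Anyₚ.tabulate⁺ x ≤-refl)))

  minLabel≤label : ∀ x → minLabel f ≤ f x
  minLabel≤label x =
    foldr-preservesᵒ {P = _≤ f x} {f = _⊓_} (λ a b → [ m≤n⇒m⊓o≤n b , m≤n⇒o⊓m≤n a ]) (maxLabel f) _
      (inj₂ (Anyₚ.map⁺ (Anyₚ.tabulate⁺ x ≤-refl)))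

  maxLabel-lub : ∀ {b} → (∀ x → f x ≤ b) → maxLabel f ≤ b
  maxLabel-lub {b} f≤b =
    foldr-preservesᵇ {P = _≤ b} {f = _⊔_} ⊔-lub z≤n (Allₚ.map⁺ (Allₚ.tabulate⁺ f≤b))

-- Dist asks for a shortest walk, which we cannot search for.  Instead, if the bound
-- failed for ℓ, then by strong induction no shorter walk exists, so ℓ is the distance.
IsL321-walk : ∀ {n} {Adj : Fin n → Fin n → Set} {f : Fin n → ℕ} → IsL321 Adj f →
              ∀ {x y} → x ≢ y → ∀ ℓ → Walk Adj x y ℓ → 3 < ∣ f x - f y ∣ + ℓ
IsL321-walk {Adj = Adj} {f} isL321 {x} {y} x≢y = <-rec _ bound
  where
  bound : ∀ ℓ → (∀ {m} → m < ℓ → Walk Adj x y m → 3 < ∣ f x - f y ∣ + m) →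
          Walk Adj x y ℓ → 3 < ∣ f x - f y ∣ + ℓ
  bound ℓ shorter w = decidable-stable (3 <? _) λ ¬sep →
    ¬sep (isL321 x y x≢y ℓ (w , λ m m<ℓ w′ →
      ¬sep (<-≤-trans (shorter m<ℓ w′) (+-monoʳ-≤ _ (<⇒≤ m<ℓ)))))

∣m∸o-n∸o∣≡∣m-n∣ : ∀ {m n o} → o ≤ m → o ≤ n → ∣ m ∸ o - n ∸ o ∣ ≡ ∣ m - n ∣
∣m∸o-n∸o∣≡∣m-n∣ {m} {n} {o} o≤m o≤n = begin
  ∣ m ∸ o - n ∸ o ∣             ≡⟨ ∣m+n-m+o∣≡∣n-o∣ o (m ∸ o) (n ∸ o) ⟨
  ∣ o + (m ∸ o) - o + (n ∸ o) ∣ ≡⟨ cong₂ ∣_-_∣ (m+[n∸m]≡n o≤m) (m+[n∸m]≡n o≤n) ⟩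
  ∣ m - n ∣                     ∎
  where open ≡-Reasoning

-- number of steps when g is covered by threes and then at most two ones
hops : ℕ → ℕ
hops 0 = 0
hops 1 = 1
hops 2 = 2
hops (suc (suc (suc g))) = suc (hops g)

module _ {n : ℕ} {S : ℕ → Set} (S1 : S 1) (S3 : S 3) where

  forward-adjacent : ∀ {s} → S s → ∀ {x y : Fin n} → toℕ x + s ≡ toℕ y → CircAdj n S x y
  forward-adjacent {s} Ss {x} x+s≡y =
    subst (λ t → S ∣ toℕ x - t ∣) x+s≡y (subst S (sym (∣m-m+n∣≡n (toℕ x) s)) Ss)

  forward-walk : ∀ g {x y : Fin n} → toℕ x + g ≡ toℕ y → Walk (CircAdj n S) x y (hops g)
  forward-step : ∀ {s} → S s → ∀ g {x y : Fin n} → toℕ x + (s + g) ≡ toℕ y →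
                 Walk (CircAdj n S) x y (suc (hops g))

  forward-walk zero {x} x+0≡y =
    subst (λ y → Walk _ x y 0) (toℕ-injective (trans (sym (+-identityʳ (toℕ x))) x+0≡y)) here
  forward-walk 1 = forward-step S1 0
  forward-walk 2 = forward-step S1 1
  forward-walk (suc (suc (suc g))) = forward-step S3 g

  forward-step {s} Ss g {x} {y} x+[s+g]≡y =
    step (forward-adjacent Ss (sym (toℕ-fromℕ< x+s<n))) (forward-walk g z+g≡y)
    where
    x+s+g≡y : toℕ x + s + g ≡ toℕ y
    x+s+g≡y = trans (+-assoc (toℕ x) s g) x+[s+g]≡y
    x+s<n : toℕ x + s < n
    x+s<n = ≤-<-trans (subst (toℕ x + s ≤_) x+s+g≡y (m≤m+n _ g)) (toℕ<n y)
    z+g≡y : toℕ (fromℕ< x+s<n) + g ≡ toℕ y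
    z+g≡y = trans (cong (_+ g) (toℕ-fromℕ< x+s<n)) x+s+g≡y

  forward-separation : ∀ {f : Fin n → ℕ} → IsL321 (CircAdj n S) f →
                       ∀ g {x y} → toℕ x + suc g ≡ toℕ y → 4 ∸ hops (suc g) ≤ ∣ f x - f y ∣
  forward-separation {f} isL321 g {x} {y} x+g≡y =
    m≤n+o⇒m∸n≤o 4 (hops (suc g)) (subst (4 ≤_) (+-comm ∣ f x - f y ∣ (hops (suc g)))
      (IsL321-walk {f = f} isL321 x≢y (hops (suc g)) (forward-walk (suc g) x+g≡y)))
    where
    x≢y : x ≢ y
    x≢y refl = m+1+n≰m (toℕ x) (≤-reflexive x+g≡y)

-- The earlier labels us of a window are listed nearest first; the head is at gap k from v.
Separated : ℕ → ℕ → List ℕ → Set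
Separated k v [] = ⊤
Separated k v (u ∷ us) = 4 ∸ hops k ≤ ∣ u - v ∣ × Separated (suc k) v us

Extendable : ℕ → ℕ → List ℕ → Set
Extendable L zero us = ⊤
Extendable L (suc r) us = ∃ λ v → v < L × Separated 1 v us × Extendable L r (v ∷ us)

separated? : ∀ k v us → Dec (Separated k v us)
separated? k v [] = yes tt
separated? k v (u ∷ us) = (4 ∸ hops k ≤? ∣ u - v ∣) ×-dec separated? (suc k) v us

extendable? : ∀ L r us → Dec (Extendable L r us)
extendable? L zero us = yes tt
extendable? L (suc r) us = anyUpTo? (λ v → separated? 1 v us ×-dec extendable? L r (v ∷ us)) L

Spread : ℕ → (ℕ → ℕ) → Set
Spread m w = ∀ i g → i + suc g < m → 4 ∸ hops (suc g) ≤ ∣ w i - w (i + suc g) ∣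

prefix : (ℕ → ℕ) → ℕ → List ℕ
prefix w zero = []
prefix w (suc p) = w p ∷ prefix w p

separated-prefix : ∀ {v} w p k → (∀ i j → suc (i + j) ≡ p → 4 ∸ hops (j + k) ≤ ∣ w i - v ∣) →
                   Separated k v (prefix w p)
separated-prefix w zero k sep = tt
separated-prefix {v} w (suc p) k sep =
  sep p 0 (cong suc (+-identityʳ p)) ,
  separated-prefix w p (suc k) λ i j 1+i+j≡p →
    subst (λ t → 4 ∸ hops t ≤ ∣ w i - v ∣) (sym (+-suc j k))
      (sep i (suc j) (cong suc (trans (+-suc i j) 1+i+j≡p)))

spread-extendable : ∀ {L m} w → (∀ i → i < m → w i < L) → Spread m w →
                    ∀ p r → p + r ≡ m → Extendable L r (prefix w p)
spread-extendable w bounded spread p zero _ = tt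
spread-extendable {m = m} w bounded spread p (suc r) p+r≡m =
  w p , bounded p p<m , separated-prefix w p 1 sep ,
  spread-extendable w bounded spread (suc p) r (trans (sym (+-suc p r)) p+r≡m)
  where
  p<m : p < m
  p<m = subst (p <_) p+r≡m (m<m+n p z<s)
  sep : ∀ i j → suc (i + j) ≡ p → 4 ∸ hops (j + 1) ≤ ∣ w i - w p ∣
  sep i j 1+i+j≡p = subst₂ (λ t q → 4 ∸ hops t ≤ ∣ w i - w q ∣) (+-comm 1 j) i+[1+j]≡p
    (spread i j (subst (_< m) (sym i+[1+j]≡p) p<m))
    where
    i+[1+j]≡p : i + suc j ≡ p
    i+[1+j]≡p = trans (+-suc i j) 1+i+j≡p

no-spread-window : ∀ w → (∀ i → i < 12 → w i < 11) → ¬ Spread 12 w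
no-spread-window w bounded spread =
  from-no (extendable? 11 12 []) (spread-extendable w bounded spread 0 12 refl)

IsL321⇒11≤span : ∀ {n S} {f : Fin n → ℕ} → S 1 → S 3 → 12 ≤ n → IsL321 (CircAdj n S) f → 11 ≤ span f
IsL321⇒11≤span {n} {S} {f} S1 S3 12≤n isL321 = decidable-stable (11 ≤? span f) λ 11≰span →
  no-spread-window w (bounded (≰⇒> 11≰span)) spread
  where
  instance
    n≢0 : NonZero n
    n≢0 = >-nonZero (<-≤-trans z<s 12≤n)
  vertex : ℕ → Fin n
  vertex i = fromℕ< (m%n<n i n)
  toℕ-vertex : ∀ {i} → i < 12 → toℕ (vertex i) ≡ i
  toℕ-vertex {i} i<12 = trans (toℕ-fromℕ< (m%n<n i n)) (m<n⇒m%n≡m (<-≤-trans i<12 12≤n))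
  μ : ℕ
  μ = minLabel f
  w : ℕ → ℕ
  w i = f (vertex i) ∸ μ
  bounded : span f < 11 → ∀ i → i < 12 → w i < 11
  bounded span<11 i _ = ≤-<-trans (∸-monoˡ-≤ μ (label≤maxLabel f (vertex i))) span<11
  spread : Spread 12 w
  spread i g i+g<12 = subst (4 ∸ hops (suc g) ≤_)
    (sym (∣m∸o-n∸o∣≡∣m-n∣ (minLabel≤label f (vertex i)) (minLabel≤label f (vertex (i + suc g)))))
    (forward-separation {S = S} S1 S3 {f = f} isL321 g
      (trans (cong (_+ suc g) (toℕ-vertex (≤-<-trans (m≤m+n i (suc g)) i+g<12)))
             (sym (toℕ-vertex i+g<12))))

-- Shift m (u , d) a b says b ≡ a + u − d (mod m), without truncated subtraction.
Shift : (m : ℕ) .{{_ : NonZero m}} → ℕ × ℕ → ℕ → ℕ → Set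
Shift m (u , d) a b = (b + d) % m ≡ (a + u) % m

_⊕_ : ℕ × ℕ → ℕ × ℕ → ℕ × ℕ
(u₁ , d₁) ⊕ (u₂ , d₂) = (u₁ + u₂ , d₁ + d₂)

module _ {m : ℕ} .{{_ : NonZero m}} where

  %-cong-+ : ∀ {x y} k → x % m ≡ y % m → (x + k) % m ≡ (y + k) % m
  %-cong-+ {x} {y} k x≡y = begin
    (x + k) % m           ≡⟨ %-distribˡ-+ x k m ⟩
    (x % m + k % m) % m   ≡⟨ cong (λ t → (t + k % m) % m) x≡y ⟩
    (y % m + k % m) % m   ≡⟨ %-distribˡ-+ y k m ⟨
    (y + k) % m           ∎
    where open ≡-Reasoning

  Shift-trans : ∀ {s t a b c} → Shift m s a b → Shift m t b c → Shift m (s ⊕ t) a c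
  Shift-trans {u₁ , d₁} {u₂ , d₂} {a} {b} {c} ab bc = begin
    (c + (d₁ + d₂)) % m   ≡⟨ cong (_% m) (x∙yz≈xz∙y c d₁ d₂) ⟩
    (c + d₂ + d₁) % m     ≡⟨ %-cong-+ d₁ bc ⟩
    (b + u₂ + d₁) % m     ≡⟨ cong (_% m) (xy∙z≈xz∙y b u₂ d₁) ⟩
    (b + d₁ + u₂) % m     ≡⟨ %-cong-+ u₂ ab ⟩
    (a + u₁ + u₂) % m     ≡⟨ cong (_% m) (+-assoc a u₁ u₂) ⟩
    (a + (u₁ + u₂)) % m   ∎
    where open ≡-Reasoning

  Shift-∣ : ∀ {k} .{{_ : NonZero k}} {s a b} → k ∣ m → Shift m s a b → Shift k s a b
  Shift-∣ {k} {u , d} {a} {b} k∣m ab = begin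
    (b + d) % k       ≡⟨ m∣n⇒o%n%m≡o%m k m (b + d) k∣m ⟨
    (b + d) % m % k   ≡⟨ cong (_% k) ab ⟩
    (a + u) % m % k   ≡⟨ m∣n⇒o%n%m≡o%m k m (a + u) k∣m ⟩
    (a + u) % k       ∎
    where open ≡-Reasoning

Shift⇒% : ∀ m .{{_ : NonZero m}} {u d a b} → Shift m (u , d) a b →
          b % m ≡ (a + (u + (m ∸ 1) * d)) % m
Shift⇒% m@(suc m′) {u} {d} {a} {b} ab = begin
  b % m                  ≡⟨ [m+kn]%n≡m%n b d m ⟨
  (b + d * m) % m        ≡⟨ cong (λ t → (b + t) % m) (*-suc d m′) ⟩
  (b + (d + d * m′)) % m ≡⟨ cong (λ t → (b + (d + t)) % m) (*-comm d m′) ⟩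
  (b + (d + m′ * d)) % m ≡⟨ cong (_% m) (+-assoc b d (m′ * d)) ⟨
  (b + d + m′ * d) % m   ≡⟨ %-cong-+ {x = b + d} {a + u} (m′ * d) ab ⟩
  (a + u + m′ * d) % m   ≡⟨ cong (_% m) (+-assoc a u (m′ * d)) ⟩
  (a + (u + m′ * d)) % m ∎
  where open ≡-Reasoning

Shift-balanced : ∀ m .{{_ : NonZero m}} {d a b} → Shift m (d , d) a b → b % m ≡ a % m
Shift-balanced m@(suc _) {d} {a} {b} ab = trans (Shift⇒% m {d} {d} {a} {b} ab)
  (trans (cong (λ t → (a + t) % m) (*-comm m d)) ([m+kn]%n≡m%n a d m))

∣-∣≡⇒+ : ∀ {a b s} → ∣ a - b ∣ ≡ s → a + s ≡ b ⊎ b + s ≡ a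
∣-∣≡⇒+ {a} {b} refl with ≤-total a b
... | inj₁ a≤b = inj₁ (trans (cong (a +_) (m≤n⇒∣m-n∣≡n∸m a≤b)) (m+[n∸m]≡n a≤b))
... | inj₂ b≤a = inj₂ (trans (cong (b +_) (m≤n⇒∣n-m∣≡n∸m b≤a)) (m+[n∸m]≡n b≤a))

module _ {m : ℕ} .{{_ : NonZero m}} {a b : ℕ} where

  private
    wrap : ∀ {s} → s ≤ m → ∀ x → x + (m ∸ s) + s ≡ x + m
    wrap {s} s≤m x = trans (+-assoc x (m ∸ s) s) (cong (x +_) (m∸n+n≡m s≤m))

  ∣-∣≡⇒Shift : ∀ {s} → ∣ a - b ∣ ≡ s → Shift m (s , 0) a b ⊎ Shift m (0 , s) a b
  ∣-∣≡⇒Shift eq with ∣-∣≡⇒+ eq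
  ... | inj₁ a+s≡b = inj₁ (cong (_% m) (trans (+-identityʳ b) (sym a+s≡b)))
  ... | inj₂ b+s≡a = inj₂ (cong (_% m) (trans b+s≡a (sym (+-identityʳ a))))

  ∣-∣≡∸⇒Shift : ∀ {s} → s ≤ m → ∣ a - b ∣ ≡ m ∸ s → Shift m (0 , s) a b ⊎ Shift m (s , 0) a b
  ∣-∣≡∸⇒Shift {s} s≤m eq with ∣-∣≡⇒+ eq
  ... | inj₁ a+[m∸s]≡b = inj₁ (begin
    (b + s) % m               ≡⟨ cong (λ t → (t + s) % m) (sym a+[m∸s]≡b) ⟩
    (a + (m ∸ s) + s) % m     ≡⟨ cong (_% m) (wrap s≤m a) ⟩
    (a + m) % m               ≡⟨ [m+n]%n≡m%n a m ⟩
    a % m                     ≡⟨ cong (_% m) (sym (+-identityʳ a)) ⟩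
    (a + 0) % m               ∎)
    where open ≡-Reasoning
  ... | inj₂ b+[m∸s]≡a = inj₂ (begin
    (b + 0) % m               ≡⟨ cong (_% m) (+-identityʳ b) ⟩
    b % m                     ≡⟨ [m+n]%n≡m%n b m ⟨
    (b + m) % m               ≡⟨ cong (_% m) (sym (wrap s≤m b)) ⟩
    (b + (m ∸ s) + s) % m     ≡⟨ cong (λ t → (t + s) % m) b+[m∸s]≡a ⟩
    (a + s) % m               ∎)
    where open ≡-Reasoning

edgeShifts : List (ℕ × ℕ)
edgeShifts = (1 , 0) ∷ (0 , 1) ∷ (3 , 0) ∷ (0 , 3) ∷ []

walkShifts : ℕ → List (ℕ × ℕ)
walkShifts zero = (0 , 0) ∷ []
walkShifts (suc ℓ) = cartesianProductWith _⊕_ edgeShifts (walkShifts ℓ)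

module _ {n : ℕ} .{{_ : NonZero n}} (3≤n : 3 ≤ n) where

  edge-Shift : ∀ {x y} → CircAdj n (S1-3 n) x y → Any (λ s → Shift n s (toℕ x) (toℕ y)) edgeShifts
  edge-Shift (inj₁ d≡1) with ∣-∣≡⇒Shift d≡1
  ... | inj₁ sh = here sh
  ... | inj₂ sh = there (here sh)
  edge-Shift (inj₂ (inj₁ d≡3)) with ∣-∣≡⇒Shift d≡3
  ... | inj₁ sh = there (there (here sh))
  ... | inj₂ sh = there (there (there (here sh)))
  edge-Shift (inj₂ (inj₂ (inj₁ d≡n∸3))) with ∣-∣≡∸⇒Shift 3≤n d≡n∸3
  ... | inj₁ sh = there (there (there (here sh)))
  ... | inj₂ sh = there (there (here sh))
  edge-Shift (inj₂ (inj₂ (inj₂ d≡n∸1))) with ∣-∣≡∸⇒Shift (≤-trans (s≤s z≤n) 3≤n) d≡n∸1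
  ... | inj₁ sh = there (here sh)
  ... | inj₂ sh = here sh

  walk-Shift : ∀ {x y ℓ} → Walk (CircAdj n (S1-3 n)) x y ℓ →
               Any (λ s → Shift n s (toℕ x) (toℕ y)) (walkShifts ℓ)
  walk-Shift here = here refl
  walk-Shift {x} {y} (step {y = z} xz zy) =
    Anyₚ.cartesianProductWith⁺ _⊕_ (λ {s} {t} → Shift-trans {s = s} {t} {toℕ x} {toℕ z} {toℕ y})
      (edge-Shift xz) (walk-Shift zy)

label5 : ℕ → ℕ
label5 a = 5 * a % 12

label5-cong : ∀ {a b} → a % 12 ≡ b % 12 → label5 a ≡ label5 b
label5-cong {a} {b} a≡b = begin
  5 * a % 12          ≡⟨ %-distribˡ-* 5 a 12 ⟩
  5 * (a % 12) % 12   ≡⟨ cong (λ t → 5 * t % 12) a≡b ⟩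
  5 * (b % 12) % 12   ≡⟨ %-distribˡ-* 5 b 12 ⟨
  5 * b % 12          ∎
  where open ≡-Reasoning

-- By Shift⇒%, a shift (u , d) moves residues mod 12 by u + 11 d.
Separates : ℕ → ℕ × ℕ → Set
Separates ℓ (u , d) = u ≢ d → ∀ {r} → r < 12 → 3 < ∣ label5 r - label5 (r + (u + 11 * d)) ∣ + ℓ

separates? : ∀ ℓ s → Dec (Separates ℓ s)
separates? ℓ (u , d) =
  ¬? (u ≟ d) →-dec allUpTo? (λ r → 3 <? ∣ label5 r - label5 (r + (u + 11 * d)) ∣ + ℓ) 12

short-walkShifts-separate : ∀ {ℓ} → ℓ < 4 → All (Separates ℓ) (walkShifts ℓ)
short-walkShifts-separate = from-yes (allUpTo? (λ ℓ → All.all? (separates? ℓ) (walkShifts ℓ)) 4)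

module _ {n : ℕ} .{{_ : NonZero n}} (12∣n : 12 ∣ n) where

  labelling5 : Fin n → ℕ
  labelling5 x = label5 (toℕ x)

  private
    12≤n : 12 ≤ n
    12≤n = ∣⇒≤ 12∣n
    3≤n : 3 ≤ n
    3≤n = ≤-trans (s≤s (s≤s (s≤s z≤n))) 12≤n

  Shift⇒separated : ∀ {x y ℓ s} → x ≢ y → Separates ℓ s → Shift n s (toℕ x) (toℕ y) →
                    3 < ∣ labelling5 x - labelling5 y ∣ + ℓ
  Shift⇒separated {x} {y} {ℓ} {u , d} x≢y sep sh with u ≟ d
  ... | yes refl = ⊥-elim (x≢y (toℕ-injective (begin
    toℕ x       ≡⟨ m<n⇒m%n≡m (toℕ<n x) ⟨
    toℕ x % n   ≡⟨ Shift-balanced n {u} {toℕ x} {toℕ y} sh ⟨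
    toℕ y % n   ≡⟨ m<n⇒m%n≡m (toℕ<n y) ⟩
    toℕ y       ∎)))
    where open ≡-Reasoning
  ... | no u≢d = subst₂ (λ p q → 3 < ∣ p - q ∣ + ℓ) x-label y-label (sep u≢d (m%n<n (toℕ x) 12))
    where
    open ≡-Reasoning
    r : ℕ
    r = toℕ x % 12
    x-label : label5 r ≡ labelling5 x
    x-label = label5-cong {r} {toℕ x} (m%n%n≡m%n (toℕ x) 12)
    y-shift : Shift 12 (u , d) (toℕ x) (toℕ y)
    y-shift = Shift-∣ {s = u , d} {toℕ x} {toℕ y} 12∣n sh
    y-label : label5 (r + (u + 11 * d)) ≡ labelling5 y
    y-label = label5-cong {r + (u + 11 * d)} {toℕ y} (begin
      (r + (u + 11 * d)) % 12     ≡⟨ %-cong-+ {x = r} {toℕ x} (u + 11 * d) (m%n%n≡m%n (toℕ x) 12) ⟩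
      (toℕ x + (u + 11 * d)) % 12 ≡⟨ Shift⇒% 12 {u} {d} {toℕ x} {toℕ y} y-shift ⟨
      toℕ y % 12                  ∎)

  labelling5-IsL321 : IsL321 (CircAdj n (S1-3 n)) labelling5
  labelling5-IsL321 x y x≢y ℓ (w , _) with ℓ <? 4
  ... | no ℓ≮4 = ≤-trans (≮⇒≥ ℓ≮4) (m≤n+m ℓ _)
  ... | yes ℓ<4 =
    let sep , sh = lookupAny (short-walkShifts-separate ℓ<4) (walk-Shift 3≤n w)
    in Shift⇒separated x≢y sep sh

  span-labelling5 : span labelling5 ≡ 11
  span-labelling5 = cong₂ _∸_ max≡11 min≡0
    where
    vertex : ∀ i → i < 12 → Fin n
    vertex i i<12 = fromℕ< (<-≤-trans i<12 12≤n)
    label-at : ∀ i (i<12 : i < 12) → labelling5 (vertex i i<12) ≡ label5 i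
    label-at i i<12 = cong label5 (toℕ-fromℕ< (<-≤-trans i<12 12≤n))
    7<12 : 7 < 12
    7<12 = s≤s (s≤s (s≤s (s≤s (s≤s (s≤s (s≤s (s≤s z≤n)))))))
    max≡11 : maxLabel labelling5 ≡ 11
    max≡11 = ≤-antisym (maxLabel-lub labelling5 (λ x → ≤-pred (m%n<n (5 * toℕ x) 12)))
      (subst (_≤ maxLabel labelling5) (label-at 7 7<12) (label≤maxLabel labelling5 (vertex 7 7<12)))
    min≡0 : minLabel labelling5 ≡ 0
    min≡0 = n≤0⇒n≡0
      (subst (minLabel labelling5 ≤_) (label-at 0 z<s) (minLabel≤label labelling5 (vertex 0 z<s)))

mainTheorem2 : (k n : ℕ) → 1 ≤ k → n ≡ 12 * k →
    λ321≡ (CircAdj n (S1-3 n)) 11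
mainTheorem2 (suc j) .(12 * suc j) _ refl =
  (labelling5 12∣n , labelling5-IsL321 12∣n , span-labelling5 12∣n) ,
  λ f → IsL321⇒11≤span {S = S1-3 n} {f} (inj₁ refl) (inj₂ (inj₁ refl)) (m≤m*n 12 (suc j))
  where
  n : ℕ
  n = 12 * suc j
  12∣n : 12 ∣ n
  12∣n = m∣m*n (suc j)
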